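{- Let $\lambda/\mu$ be a connected skew shape with $\mu\neq\emptyset$ such that $\lambda_d\ge\mu_r+d-r$, where $d=\ell(\lambda)$ and $r=\max\{i\mid\mu_i=\mu_1\}$. Then $\Psi$ is a bijection from $\mathcal{E}^{\nearrow}(\lambda/\mu)$ to $\mathcal{OOT}(\lambda/\mu)$, and it is weight preserving: if $\Psi(D)=T$ then \[ \prod_{(i,j)\in D}h(i,j)=\prod_{(i,j)\in[\mu]}\big(\lambda_{d+1-T(i,j)}+i-j\big). \]
   Context: $[\lambda]=\{(i,j):1\le i\le\ell(\lambda),1\le j\le\lambda_i\}$ (English convention), $\lambda'$ conjugate, hook length $h(i,j)=\lambda_i-i+\lambda'_j-j+1$. $\mathcal{OOT}(\lambda/\mu)$ is the set of SSYT $T$ of shape $\mu$ (weakly increasing rows, strictly increasing columns) with entries in $\{1,\dots,d\}$ such that $j-i<\lambda_{d+1-T(i,j)}$ for all $(i,j)\in[\mu]$. NE-excited diagrams: let $[\widehat\mu]=\{(d+1-x,y):(x,y)\in[\mu]\}$ (under the hypothesis, $[\widehat\mu]\subseteq[\lambda/\mu]$). An NE-excited move on $D\subseteq[\lambda]$ replaces a cell $(i,j)\in D$ by $(i-1,j+1)$, provided $(i-1,j),(i-1,j+1),(i,j+1)$ all lie in $[\lambda]\setminus D$. $\mathcal{E}^{\nearrow}(\lambda/\mu)$ is the set of diagrams obtained from $[\widehat\mu]$ by finite sequences of NE-excited moves; each cell of such a $D$ corresponds to the cell of $[\widehat\mu]$ it was moved from. The map $\Psi$: for $D\in\mathcal{E}^{\nearrow}(\lambda/\mu)$,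 $\Psi(D)$ is the filling $T$ of $[\mu]$ with $T(x,y)=d+1-i_x$, where $(i_x,j_y)$ is the cell of $D$ corresponding to the cell $(d+1-x,y)$ of $[\widehat\mu]$. -}

module Defs where

open import Data.Nat using (ℕ; zero; suc; _+_; _*_; _∸_; _≤_; _<_; _≤?_)
open import Data.Nat.ListAction using (product)
open import Data.List using (List; []; _∷_; length; map; filter; concat; upTo; lookup; _[_]∷=_; take; drop)
open import Data.List.Membership.Propositional using (_∈_; _∉_)
open import Data.List.Relation.Unary.All using (All)
open import Data.Product using (Σ; ∃; _×_; _,_; proj₁; proj₂)
open import Data.Sum using (_⊎_)
open import Data.Fin using (Fin)
open import Relation.Nullary using (¬_)
open import Relation.Binary.PropositionalEquality using (_≡_)
open import Relation.Binary.Construct.Closure.ReflexiveTransitive using (Star)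

-- Partitions as lists of parts; everything is 1-indexed.

at : List ℕ → ℕ → ℕ
at []       _             = 0
at (x ∷ xs) zero          = 0
at (x ∷ xs) (suc zero)    = x
at (x ∷ xs) (suc (suc n)) = at xs (suc n)

row : List (List ℕ) → ℕ → List ℕ
row []       _             = []
row (x ∷ xs) zero          = []
row (x ∷ xs) (suc zero)    = x
row (x ∷ xs) (suc (suc n)) = row xs (suc n)

part : List ℕ → ℕ → ℕ
part = at

IsPartition : List ℕ → Set
IsPartition λ′ = All (λ p → 1 ≤ p) λ′ × (∀ i → 1 ≤ i → part λ′ (suc i) ≤ part λ′ i)

conj : List ℕ → ℕ → ℕ
conj λ′ j = length (filter (j ≤?_) λ′)

Cell : Set
Cell = ℕ × ℕ

InDiag : List ℕ → Cell → Set
InDiag λ′ (i , j) = 1 ≤ i × 1 ≤ j × j ≤ part λ′ i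

-- hook length h(i,j) = λ_i - i + λ'_j - j + 1 (for cells of [λ] no truncation occurs)
hook : List ℕ → Cell → ℕ
hook λ′ (i , j) = (part λ′ i ∸ j) + (conj λ′ j ∸ i) + 1

Contained : List ℕ → List ℕ → Set
Contained μ λ′ = ∀ i → part μ i ≤ part λ′ i

InSkew : List ℕ → List ℕ → Cell → Set
InSkew λ′ μ c = InDiag λ′ c × ¬ InDiag μ c

Adj : Cell → Cell → Set
Adj (i , j) (i′ , j′) =
  (i ≡ i′ × (suc j ≡ j′ ⊎ j ≡ suc j′)) ⊎ (j ≡ j′ × (suc i ≡ i′ ⊎ i ≡ suc i′))

SkewStep : List ℕ → List ℕ → Cell → Cell → Set
SkewStep λ′ μ c c′ = InSkew λ′ μ c × InSkew λ′ μ c′ × Adj c c′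

Connected : List ℕ → List ℕ → Set
Connected λ′ μ =
  (∃ λ c → InSkew λ′ μ c) ×
  (∀ c c′ → InSkew λ′ μ c → InSkew λ′ μ c′ → Star (SkewStep λ′ μ) c c′)

-- Tableaux: a filling of shape μ is a list of rows, row x of length μ_x.

entry : List (List ℕ) → ℕ → ℕ → ℕ
entry T i j = at (row T i) j

OOT : List ℕ → List ℕ → List (List ℕ) → Set
OOT λ′ μ T =
  map length T ≡ μ ×
  (∀ i j → InDiag μ (i , j) → 1 ≤ entry T i j × entry T i j ≤ length λ′) ×
  (∀ i j → InDiag μ (i , j) → InDiag μ (i , suc j) → entry T i j ≤ entry T i (suc j)) ×
  (∀ i j → InDiag μ (i , j) → InDiag μ (suc i , j) → entry T i j < entry T (suc i) j) ×
  -- j - i < λ_{d+1-T(i,j)}, written in ℕ as j < λ_{d+1-T(i,j)} + i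
  (∀ i j → InDiag μ (i , j) → j < part λ′ (suc (length λ′) ∸ entry T i j) + i)

-- Excited diagrams, labelled: a diagram is a list of cells whose k-th
-- entry is the current position of the k-th cell of [μ̂] (cells of μ in
-- row-major order).

cellsOf : List ℕ → List Cell
cellsOf μ = concat (map (λ x → map (λ y → (x , suc y)) (upTo (part μ x))) (map suc (upTo (length μ))))

muHat : ℕ → List ℕ → List Cell
muHat d μ = map (λ c → (suc d ∸ proj₁ c , proj₂ c)) (cellsOf μ)

Free : List ℕ → List Cell → Cell → Set
Free λ′ D c = InDiag λ′ c × c ∉ D

NEMove : List ℕ → List Cell → List Cell → Set
NEMove λ′ D D′ =
  Σ (Fin (length D)) λ k →
    let i = proj₁ (lookup D k) ; j = proj₂ (lookup D k) in
    Free λ′ D (i ∸ 1 , j) × Free λ′ D (i ∸ 1 , suc j) × Free λ′ D (i , suc j) ×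
    D′ ≡ (D [ k ]∷= (i ∸ 1 , suc j))

Excited : List ℕ → List ℕ → List Cell → Set
Excited λ′ μ D = Star (NEMove λ′) (muHat (length λ′) μ) D

chunks : {A : Set} → List ℕ → List A → List (List A)
chunks []       xs = []
chunks (n ∷ ns) xs = take n xs ∷ chunks ns (drop n xs)

Ψ : List ℕ → List ℕ → List Cell → List (List ℕ)
Ψ λ′ μ D = chunks μ (map (λ c → suc (length λ′) ∸ proj₁ c) D)

hookWeight : List ℕ → List Cell → ℕ
hookWeight λ′ D = product (map (hook λ′) D)

tabWeight : List ℕ → List ℕ → List (List ℕ) → ℕ
tabWeight λ′ μ T =
  product (map (λ c → (part λ′ (suc (length λ′) ∸ entry T (proj₁ c) (proj₂ c)) + proj₁ c) ∸ proj₂ c)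
               (cellsOf μ))

-- The cell of [μ̂] coming from (x , y) ∈ [μ] can only travel along its diagonal, so an NE-excited
-- diagram is determined by a filling t of [μ]: the cell sits at (d + 1 − t(x , y) , y + t(x , y) − x),
-- [μ̂] itself corresponds to t(x , y) = x, and a move raises one entry by one. The three cells a move
-- needs free are exactly what keeps t semistandard with entries ≤ d, and Ψ reads t back off the
-- diagram. Conversely, any semistandard t with entries ≤ d is reached from t(x , y) = x: lowering an
-- entry whose left and upper neighbours leave room undoes a legal move, by induction on Σ (t(x , y) − x).
-- Finally λ_d ≥ μ_r + d − r puts every placed cell in a column j ≤ λ_d. Hence all these fillings are
-- OOT, λ′_j = d, and the hook at the cell placed from (x , y) is λ_{d+1−t} + x − y.

module Submission where

open import Defs
open import Data.Nat using (ℕ; zero; suc; pred; _+_; _∸_; _≤_; _<_; _≟_; _≤?_; z≤n; s≤s; s≤s⁻¹; >-nonZero)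
open import Data.Nat.Properties
open import Data.Nat.ListAction using (product; sum)
open import Data.Nat.Tactic.RingSolver using (solve-∀)
open import Data.List using (List; []; _∷_; length; map; concat; upTo; applyUpTo; lookup; _[_]∷=_; take; drop; _++_)
open import Data.List.Properties using (map-∘; map-++; map-upTo; length-map; length-upTo; map-cong-local; filter-all)
open import Data.List.Membership.Propositional using (_∈_; _∉_)
open import Data.List.Membership.Propositional.Properties using (∈-map⁺; ∈-map⁻; ∈-++⁺ˡ; ∈-++⁺ʳ; ∈-++⁻; ∈-upTo⁺; ∈-upTo⁻)
open import Data.List.Relation.Unary.All as All using (All)
open import Data.List.Relation.Unary.Any using (here; there)
import Data.List.Relation.Unary.AllPairs as AllPairs
open import Data.List.Relation.Unary.Unique.Propositional using (Unique)
import Data.List.Relation.Unary.Unique.Propositional.Properties as Unique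
open import Data.Fin using (Fin; zero; suc)
open import Data.Product using (Σ; ∃; _×_; _,_; proj₁; proj₂)
open import Data.Product.Properties using (≡-dec)
open import Data.Sum using (_⊎_; inj₁; inj₂)
open import Data.Empty using (⊥; ⊥-elim)
open import Function using (_∘_)
open import Relation.Nullary using (¬_; Dec; yes; no)
open import Relation.Binary.Construct.Closure.ReflexiveTransitive using (Star; ε; _◅_; _◅◅_)
open import Relation.Binary.PropositionalEquality

private
  variable
    A B : Set

cross-≤ : ∀ {a b m n} → a + m ≡ b + n → n ≤ m → a ≤ b
cross-≤ {a} {b} {m} {n} eq n≤m = +-cancelʳ-≤ m a b (≤-trans (≤-reflexive eq) (+-monoʳ-≤ b n≤m))

m+n≰m : ∀ {m n} → 0 < n → m + n ≤ m → ⊥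
m+n≰m {m} 0<n le = 1+n≰n (subst (_≤ m) (+-comm m 1) (≤-trans (+-monoʳ-≤ m 0<n) le))

suc-m+n≰m : ∀ {m n} → suc m + n ≤ m → ⊥
suc-m+n≰m {m} le = 1+n≰n (m+n≤o⇒m≤o (suc m) le)

1≤m∸n⇒n<m : ∀ {m n} → 1 ≤ m ∸ n → n < m
1≤m∸n⇒n<m 1≤m∸n = m∸n≢0⇒n<m λ m∸n≡0 → 1+n≰n (subst (1 ≤_) m∸n≡0 1≤m∸n)

∸-suc : ∀ m n → m ∸ n ∸ 1 ≡ m ∸ suc n
∸-suc m n = trans (∸-+-assoc m n 1) (cong (m ∸_) (+-comm n 1))

map-cong-∈ : {f g : A → B} (xs : List A) → (∀ {a} → a ∈ xs → f a ≡ g a) → map f xs ≡ map g xs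
map-cong-∈ xs f≡g = map-cong-local (All.tabulate f≡g)

take-length-++ : (xs ys : List A) → take (length xs) (xs ++ ys) ≡ xs
take-length-++ []       ys = refl
take-length-++ (x ∷ xs) ys = cong (x ∷_) (take-length-++ xs ys)

drop-length-++ : (xs ys : List A) → drop (length xs) (xs ++ ys) ≡ ys
drop-length-++ []       ys = refl
drop-length-++ (x ∷ xs) ys = drop-length-++ xs ys

chunks-++ : (xs ys : List A) (ns : List ℕ) → chunks (length xs ∷ ns) (xs ++ ys) ≡ xs ∷ chunks ns ys
chunks-++ xs ys ns = cong₂ (λ a b → a ∷ chunks ns b) (take-length-++ xs ys) (drop-length-++ xs ys)

-- lookup xs k, for k typed as an index into map h xs.
source : (h : A → B) (xs : List A) → Fin (length (map h xs)) → A
source h (x ∷ xs) zero    = x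
source h (x ∷ xs) (suc k) = source h xs k

lookup-map-source : (h : A → B) (xs : List A) (k : Fin (length (map h xs))) → lookup (map h xs) k ≡ h (source h xs k)
lookup-map-source h (x ∷ xs) zero    = refl
lookup-map-source h (x ∷ xs) (suc k) = lookup-map-source h xs k

source-∈ : (h : A → B) (xs : List A) (k : Fin (length (map h xs))) → source h xs k ∈ xs
source-∈ h (x ∷ xs) zero    = here refl
source-∈ h (x ∷ xs) (suc k) = there (source-∈ h xs k)

∈⇒source : (h : A → B) (xs : List A) {a : A} → a ∈ xs → Σ (Fin (length (map h xs))) λ k → source h xs k ≡ a
∈⇒source h (x ∷ xs) (here refl) = zero , refl
∈⇒source h (x ∷ xs) (there a∈) with k , refl ← ∈⇒source h xs a∈ = suc k , refl

map-∷= : (h h′ : A → B) (xs : List A) (k : Fin (length (map h xs))) → Unique xs →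
         (∀ a → a ∈ xs → a ≢ source h xs k → h′ a ≡ h a) → (map h xs [ k ]∷= h′ (source h xs k)) ≡ map h′ xs
map-∷= h h′ (x ∷ xs) zero    (x∉xs AllPairs.∷ _) h≡h′ =
  cong (h′ x ∷_) (sym (map-cong-∈ xs λ {a} a∈ → h≡h′ a (there a∈) λ a≡x → All.lookup x∉xs a∈ (sym a≡x)))
map-∷= h h′ (x ∷ xs) (suc k) (x∉xs AllPairs.∷ xs!) h≡h′ =
  cong₂ _∷_ (sym (h≡h′ x (here refl) (All.lookup x∉xs (source-∈ h xs k))))
            (map-∷= h h′ xs k xs! λ a a∈ → h≡h′ a (there a∈))

≤-everywhere-or-witness : (f g : A → ℕ) (xs : List A) →
                          (∀ {a} → a ∈ xs → f a ≤ g a) ⊎ ∃ λ a → a ∈ xs × g a < f a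
≤-everywhere-or-witness f g []       = inj₁ λ ()
≤-everywhere-or-witness f g (x ∷ xs) with f x ≤? g x | ≤-everywhere-or-witness f g xs
... | no fx≰gx | _                     = inj₂ (x , here refl , ≰⇒> fx≰gx)
... | yes _    | inj₂ (a , a∈ , ga<fa) = inj₂ (a , there a∈ , ga<fa)
... | yes fx≤gx | inj₁ f≤g             = inj₁ λ { (here refl) → fx≤gx ; (there a∈) → f≤g a∈ }

sum-map-mono : (f g : A → ℕ) (xs : List A) → (∀ {a} → a ∈ xs → f a ≤ g a) → sum (map f xs) ≤ sum (map g xs)
sum-map-mono f g []       f≤g = z≤n
sum-map-mono f g (x ∷ xs) f≤g = +-mono-≤ (f≤g (here refl)) (sum-map-mono f g xs (f≤g ∘ there))

sum-map-strict : (f g : A → ℕ) (xs : List A) → (∀ {a} → a ∈ xs → f a ≤ g a) →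
                 ∀ {a} → a ∈ xs → f a < g a → sum (map f xs) < sum (map g xs)
sum-map-strict f g (x ∷ xs) f≤g (here refl) fx<gx = +-mono-<-≤ fx<gx (sum-map-mono f g xs (f≤g ∘ there))
sum-map-strict f g (x ∷ xs) f≤g (there a∈)  fa<ga =
  +-mono-≤-< (f≤g (here refl)) (sum-map-strict f g xs (f≤g ∘ there) a∈ fa<ga)

shiftDown : Cell → Cell
shiftDown (x , y) = (suc x , y)

firstRow : ℕ → List Cell
firstRow m = map (λ y → (1 , suc y)) (upTo m)

cells : List ℕ → List Cell
cells []      = []
cells (m ∷ μ) = firstRow m ++ map shiftDown (cells μ)

private
  rowCells : List ℕ → ℕ → List Cell
  rowCells μ x = map (λ y → (x , suc y)) (upTo (part μ x))

  rowCells-shift : ∀ m μ xs → concat (map (rowCells (m ∷ μ)) (map suc (map suc xs)))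
                              ≡ map shiftDown (concat (map (rowCells μ) (map suc xs)))
  rowCells-shift m μ []       = refl
  rowCells-shift m μ (k ∷ xs) = begin
      rowCells (m ∷ μ) (suc (suc k)) ++ concat (map (rowCells (m ∷ μ)) (map suc (map suc xs)))
    ≡⟨ cong₂ _++_ (map-∘ (upTo (part μ (suc k)))) (rowCells-shift m μ xs) ⟩
      map shiftDown (rowCells μ (suc k)) ++ map shiftDown (concat (map (rowCells μ) (map suc xs)))
    ≡⟨ map-++ shiftDown (rowCells μ (suc k)) _ ⟨
      map shiftDown (rowCells μ (suc k) ++ concat (map (rowCells μ) (map suc xs))) ∎
    where open ≡-Reasoning

cellsOf≡cells : ∀ μ → cellsOf μ ≡ cells μ
cellsOf≡cells []      = refl
cellsOf≡cells (m ∷ μ) = begin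
    cellsOf (m ∷ μ)
  ≡⟨ cong (λ z → firstRow m ++ concat (map (rowCells (m ∷ μ)) (map suc z))) (map-upTo suc (length μ)) ⟨
    firstRow m ++ concat (map (rowCells (m ∷ μ)) (map suc (map suc (upTo (length μ)))))
  ≡⟨ cong (firstRow m ++_) (rowCells-shift m μ (upTo (length μ))) ⟩
    firstRow m ++ map shiftDown (cellsOf μ)
  ≡⟨ cong (λ z → firstRow m ++ map shiftDown z) (cellsOf≡cells μ) ⟩
    cells (m ∷ μ) ∎
  where open ≡-Reasoning

∈-cells⁻ : ∀ μ {c} → c ∈ cells μ → InDiag μ c
∈-cells⁻ (m ∷ μ) c∈ with ∈-++⁻ (firstRow m) c∈
... | inj₁ c∈row with _ , y∈ , refl ← ∈-map⁻ _ c∈row = s≤s z≤n , s≤s z≤n , ∈-upTo⁻ y∈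
... | inj₂ c∈rest with (x , y) , c′∈ , refl ← ∈-map⁻ shiftDown c∈rest with ∈-cells⁻ μ c′∈
...   | s≤s _ , 1≤y , y≤μx = s≤s z≤n , 1≤y , y≤μx

∈-cells⁺ : ∀ μ {x y} → InDiag μ (x , y) → (x , y) ∈ cells μ
∈-cells⁺ []      {y = zero}  (_ , () , _)
∈-cells⁺ []      {y = suc _} (_ , _ , ())
∈-cells⁺ (m ∷ μ) {suc zero}    {suc y} (_ , _ , y<m) = ∈-++⁺ˡ (∈-map⁺ _ (∈-upTo⁺ y<m))
∈-cells⁺ (m ∷ μ) {suc (suc x)} {y}     (_ , 1≤y , y≤μx) =
  ∈-++⁺ʳ (firstRow m) (∈-map⁺ shiftDown (∈-cells⁺ μ (s≤s z≤n , 1≤y , y≤μx)))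

cells-unique : ∀ μ → Unique (cells μ)
cells-unique []      = AllPairs.[]
cells-unique (m ∷ μ) = Unique.++⁺ (Unique.map⁺ row-injective (Unique.upTo⁺ m))
                                   (Unique.map⁺ shiftDown-injective (cells-unique μ)) disjoint
  where
  row-injective : ∀ {a b} → (1 , suc a) ≡ (1 , suc b) → a ≡ b
  row-injective refl = refl
  shiftDown-injective : ∀ {a b} → shiftDown a ≡ shiftDown b → a ≡ b
  shiftDown-injective {_ , _} {_ , _} refl = refl
  disjoint : ∀ {c} → ¬ (c ∈ firstRow m × c ∈ map shiftDown (cells μ))
  disjoint (c∈row , c∈rest) with _ , _ , refl ← ∈-map⁻ _ c∈row | (x , _) , c′∈ , eq ← ∈-map⁻ shiftDown c∈rest
    with ∈-cells⁻ μ c′∈ | eq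
  ... | () , _ | refl

tableau : List ℕ → (Cell → A) → List (List A)
tableau μ f = chunks μ (map f (cells μ))

private
  length-map-firstRow : (f : Cell → A) (m : ℕ) → length (map f (firstRow m)) ≡ m
  length-map-firstRow f m = trans (length-map f (firstRow m)) (trans (length-map _ (upTo m)) (length-upTo m))

  map-firstRow : (f : Cell → A) (m : ℕ) → map f (firstRow m) ≡ applyUpTo (λ y → f (1 , suc y)) m
  map-firstRow f m = trans (sym (map-∘ (upTo m))) (map-upTo _ m)

tableau-cons : ∀ m μ (f : Cell → A) → tableau (m ∷ μ) f ≡ map f (firstRow m) ∷ tableau μ (f ∘ shiftDown)
tableau-cons m μ f = begin
    chunks (m ∷ μ) (map f (firstRow m ++ map shiftDown (cells μ)))
  ≡⟨ cong (chunks (m ∷ μ)) (map-++ f (firstRow m) _) ⟩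
    chunks (m ∷ μ) (map f (firstRow m) ++ map f (map shiftDown (cells μ)))
  ≡⟨ cong (λ n → chunks (n ∷ μ) (map f (firstRow m) ++ map f (map shiftDown (cells μ)))) (length-map-firstRow f m) ⟨
    chunks (length (map f (firstRow m)) ∷ μ) (map f (firstRow m) ++ map f (map shiftDown (cells μ)))
  ≡⟨ chunks-++ (map f (firstRow m)) _ μ ⟩
    map f (firstRow m) ∷ chunks μ (map f (map shiftDown (cells μ)))
  ≡⟨ cong (λ z → map f (firstRow m) ∷ chunks μ z) (map-∘ (cells μ)) ⟨
    map f (firstRow m) ∷ tableau μ (f ∘ shiftDown) ∎
  where open ≡-Reasoning

map-length-tableau : ∀ μ (f : Cell → A) → map length (tableau μ f) ≡ μ
map-length-tableau []      f = refl
map-length-tableau (m ∷ μ) f = trans (cong (map length) (tableau-cons m μ f))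
  (cong₂ _∷_ (length-map-firstRow f m) (map-length-tableau μ (f ∘ shiftDown)))

at-applyUpTo : ∀ (g : ℕ → ℕ) m y → y < m → at (applyUpTo g m) (suc y) ≡ g y
at-applyUpTo g (suc m) zero    _         = refl
at-applyUpTo g (suc m) (suc y) (s≤s y<m) = at-applyUpTo (g ∘ suc) m y y<m

entry-tableau : ∀ μ (f : Cell → ℕ) {x y} → InDiag μ (x , y) → entry (tableau μ f) x y ≡ f (x , y)
entry-tableau []      f {y = zero}  (_ , () , _)
entry-tableau []      f {y = suc _} (_ , _ , ())
entry-tableau (m ∷ μ) f {suc zero} {suc y} (_ , _ , y<m) = begin
    entry (tableau (m ∷ μ) f) 1 (suc y)      ≡⟨ cong (λ T → entry T 1 (suc y)) (tableau-cons m μ f) ⟩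
    at (map f (firstRow m)) (suc y)          ≡⟨ cong (λ r → at r (suc y)) (map-firstRow f m) ⟩
    at (applyUpTo _ m) (suc y)               ≡⟨ at-applyUpTo _ m y y<m ⟩
    f (1 , suc y)                            ∎
  where open ≡-Reasoning
entry-tableau (m ∷ μ) f {suc (suc x)} {y} (_ , 1≤y , y≤μx) =
  trans (cong (λ T → entry T (suc (suc x)) y) (tableau-cons m μ f))
        (entry-tableau μ (f ∘ shiftDown) (s≤s z≤n , 1≤y , y≤μx))

tableau-cong : ∀ μ {f g : Cell → A} → (∀ {c} → InDiag μ c → f c ≡ g c) → tableau μ f ≡ tableau μ g
tableau-cong μ f≡g = cong (chunks μ) (map-cong-∈ (cells μ) (f≡g ∘ ∈-cells⁻ μ))

tableau-injective : ∀ μ {t t′ : Cell → ℕ} → tableau μ t ≡ tableau μ t′ → ∀ {c} → InDiag μ c → t c ≡ t′ c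
tableau-injective μ {t} {t′} eq {x , y} c =
  trans (sym (entry-tableau μ t c)) (trans (cong (λ T → entry T x y) eq) (entry-tableau μ t′ c))

entryAt : List (List ℕ) → Cell → ℕ
entryAt T (x , y) = entry T x y

tableau-entryAt : ∀ T → tableau (map length T) (entryAt T) ≡ T
tableau-entryAt []      = refl
tableau-entryAt (r ∷ T) = begin
    tableau (length r ∷ map length T) (entryAt (r ∷ T))
  ≡⟨ tableau-cons (length r) (map length T) (entryAt (r ∷ T)) ⟩
    map (entryAt (r ∷ T)) (firstRow (length r)) ∷ tableau (map length T) (entryAt (r ∷ T) ∘ shiftDown)
  ≡⟨ cong₂ _∷_ (trans (map-firstRow (entryAt (r ∷ T)) (length r)) (applyUpTo-at r))
               (tableau-cong (map length T) lower-rows) ⟩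
    r ∷ tableau (map length T) (entryAt T)
  ≡⟨ cong (r ∷_) (tableau-entryAt T) ⟩
    r ∷ T ∎
  where
  open ≡-Reasoning
  applyUpTo-at : ∀ (r : List ℕ) → applyUpTo (λ y → at r (suc y)) (length r) ≡ r
  applyUpTo-at []      = refl
  applyUpTo-at (a ∷ r) = cong (a ∷_) (applyUpTo-at r)
  lower-rows : ∀ {c} → InDiag (map length T) c → entryAt (r ∷ T) (shiftDown c) ≡ entryAt T c
  lower-rows {suc x , y} _ = refl

part-antitone : ∀ {P} → IsPartition P → ∀ {i i′} → 1 ≤ i → i ≤ i′ → part P i′ ≤ part P i
part-antitone {P} (_ , step) {i} 1≤i i≤i′ = subst (λ k → part P k ≤ part P i) (m+[n∸m]≡n i≤i′) (go (_ ∸ i))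
  where
  go : ∀ k → part P (i + k) ≤ part P i
  go zero    = ≤-reflexive (cong (part P) (+-identityʳ i))
  go (suc k) = begin
    part P (i + suc k)  ≡⟨ cong (part P) (+-suc i k) ⟩
    part P (suc (i + k)) ≤⟨ step (i + k) (≤-trans 1≤i (m≤m+n i k)) ⟩
    part P (i + k)      ≤⟨ go k ⟩
    part P i            ∎
    where open ≤-Reasoning

at-pos⇒≤length : ∀ P x → 1 ≤ at P x → x ≤ length P
at-pos⇒≤length (a ∷ P) zero          _   = z≤n
at-pos⇒≤length (a ∷ P) (suc zero)    _   = s≤s z≤n
at-pos⇒≤length (a ∷ P) (suc (suc x)) pos = s≤s (at-pos⇒≤length P (suc x) pos)

∈⇒part : ∀ {P p} → p ∈ P → ∃ λ i → 1 ≤ i × i ≤ length P × part P i ≡ p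
∈⇒part (here refl) = 1 , s≤s z≤n , s≤s z≤n , refl
∈⇒part {_ ∷ P} (there p∈) with ∈⇒part p∈
... | suc i , _ , i≤ , eq = suc (suc i) , s≤s z≤n , s≤s i≤ , eq

last-part-≤ : ∀ {P p} → IsPartition P → p ∈ P → part P (length P) ≤ p
last-part-≤ pP p∈ with i , 1≤i , i≤ , refl ← ∈⇒part p∈ = part-antitone pP 1≤i i≤

conj≡length : ∀ {P j} → IsPartition P → j ≤ part P (length P) → conj P j ≡ length P
conj≡length pP j≤ = cong length (filter-all (_ ≤?_) (All.tabulate λ p∈ → ≤-trans j≤ (last-part-≤ pP p∈)))

InDiag-up : ∀ {μ x x′ y} → IsPartition μ → InDiag μ (x , y) → 1 ≤ x′ → x′ ≤ x → InDiag μ (x′ , y)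
InDiag-up pμ (_ , 1≤y , y≤μx) 1≤x′ x′≤x = 1≤x′ , 1≤y , ≤-trans y≤μx (part-antitone pμ 1≤x′ x′≤x)

InDiag-left : ∀ μ {x y y′} → InDiag μ (x , y) → 1 ≤ y′ → y′ ≤ y → InDiag μ (x , y′)
InDiag-left _ (1≤x , _ , y≤μx) 1≤y′ y′≤y = 1≤x , 1≤y′ , ≤-trans y′≤y y≤μx

-- Semistandard fillings of [μ] by 1 … d, as functions on cells

record Semistandard (d : ℕ) (μ : List ℕ) (t : Cell → ℕ) : Set where
  field
    entry-pos     : ∀ {x y} → InDiag μ (x , y) → 1 ≤ t (x , y)
    entry-≤d      : ∀ {x y} → InDiag μ (x , y) → t (x , y) ≤ d
    row-weak      : ∀ {x y} → InDiag μ (x , y) → InDiag μ (x , suc y) → t (x , y) ≤ t (x , suc y)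
    column-strict : ∀ {x y} → InDiag μ (x , y) → InDiag μ (suc x , y) → t (x , y) < t (suc x , y)

OOT⇒semistandard : ∀ {λ′ μ T} → OOT λ′ μ T → Semistandard (length λ′) μ (entryAt T)
OOT⇒semistandard (_ , bounds , rows , columns , _) = record
  { entry-pos     = λ c → proj₁ (bounds _ _ c)
  ; entry-≤d      = λ c → proj₂ (bounds _ _ c)
  ; row-weak      = rows _ _
  ; column-strict = columns _ _
  }

module _ {d : ℕ} {μ : List ℕ} (pμ : IsPartition μ) {t : Cell → ℕ} (S : Semistandard d μ t) where
  open Semistandard S

  row-mono : ∀ {x y y′} → InDiag μ (x , y) → InDiag μ (x , y′) → y ≤ y′ → t (x , y) ≤ t (x , y′)
  row-mono {y′ = suc y′} c c′ y≤y′ with m≤n⇒m<n∨m≡n y≤y′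
  ... | inj₂ refl      = ≤-refl
  ... | inj₁ (s≤s y≤) = ≤-trans (row-mono c left y≤) (row-weak left c′)
    where left = InDiag-left μ c′ (≤-trans (proj₁ (proj₂ c)) y≤) (n≤1+n y′)

  column-mono : ∀ {x x′ y} → InDiag μ (x , y) → InDiag μ (x′ , y) → x ≤ x′ → t (x , y) + (x′ ∸ x) ≤ t (x′ , y)
  column-mono {x} {suc x′} {y} c c′ x≤x′ with m≤n⇒m<n∨m≡n x≤x′
  ... | inj₂ refl      = ≤-reflexive (trans (cong (t (x , y) +_) (n∸n≡0 x)) (+-identityʳ _))
  ... | inj₁ (s≤s x≤) = begin
      t (x , y) + (suc x′ ∸ x)   ≡⟨ cong (t (x , y) +_) (+-∸-assoc 1 x≤) ⟩
      t (x , y) + suc (x′ ∸ x)   ≡⟨ +-suc _ _ ⟩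
      suc (t (x , y) + (x′ ∸ x)) ≤⟨ s≤s (column-mono c above x≤) ⟩
      suc (t (x′ , y))           ≤⟨ column-strict above c′ ⟩
      t (suc x′ , y)             ∎
    where
    open ≤-Reasoning
    above = InDiag-up pμ c′ (≤-trans (proj₁ c) x≤) (n≤1+n x′)

  southeast-mono : ∀ {x y x′ y′} → InDiag μ (x , y) → InDiag μ (x′ , y′) → x ≤ x′ → y ≤ y′ →
                   t (x , y) + (x′ ∸ x) ≤ t (x′ , y′)
  southeast-mono c c′ x≤x′ y≤y′ =
    ≤-trans (column-mono c corner x≤x′) (row-mono corner c′ y≤y′)
    where corner = InDiag-left μ c′ (proj₁ (proj₂ c)) y≤y′

  row≤entry : ∀ {x y} → InDiag μ (x , y) → x ≤ t (x , y)
  row≤entry {x} {y} c = begin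
    x                        ≡⟨ m+[n∸m]≡n (proj₁ c) ⟨
    1 + (x ∸ 1)              ≤⟨ +-monoˡ-≤ _ (entry-pos top) ⟩
    t (1 , y) + (x ∸ 1)      ≤⟨ column-mono top c (proj₁ c) ⟩
    t (x , y)                ∎
    where
    open ≤-Reasoning
    top = InDiag-up pμ c ≤-refl (proj₁ c)

_≟ᶜ_ : (a b : Cell) → Dec (a ≡ b)
_≟ᶜ_ = ≡-dec _≟_ _≟_

update : (Cell → ℕ) → Cell → ℕ → Cell → ℕ
update t c v a with a ≟ᶜ c
... | yes _ = v
... | no  _ = t a

update-≡ : ∀ t c v → update t c v c ≡ v
update-≡ t c v with c ≟ᶜ c
... | yes _   = refl
... | no  c≢c = ⊥-elim (c≢c refl)

update-≢ : ∀ t c v {a} → a ≢ c → update t c v a ≡ t a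
update-≢ t c v {a} a≢c with a ≟ᶜ c
... | yes a≡c = ⊥-elim (a≢c a≡c)
... | no  _   = refl

update-cases : ∀ t c v a → (a ≡ c × update t c v a ≡ v) ⊎ (a ≢ c × update t c v a ≡ t a)
update-cases t c v a with a ≟ᶜ c
... | yes a≡c = inj₁ (a≡c , refl)
... | no  a≢c = inj₂ (a≢c , refl)

-- When v may replace t (x , y) in a semistandard filling.
record FitsAt (d : ℕ) (μ : List ℕ) (t : Cell → ℕ) (x y v : ℕ) : Set where
  field
    pos     : 1 ≤ v
    ≤d      : v ≤ d
    left≤   : ∀ {y₀} → InDiag μ (x , y₀) → suc y₀ ≡ y → t (x , y₀) ≤ v
    ≤right  : InDiag μ (x , suc y) → v ≤ t (x , suc y)
    above<  : ∀ {x₀} → InDiag μ (x₀ , y) → suc x₀ ≡ x → t (x₀ , y) < v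
    <below  : InDiag μ (suc x , y) → v < t (suc x , y)

update-semistandard : ∀ {d μ t x y v} → Semistandard d μ t → FitsAt d μ t x y v →
                      Semistandard d μ (update t (x , y) v)
update-semistandard {d} {μ} {t} {x} {y} {v} S F = record
  { entry-pos     = λ {a} {b} c → replaced (a , b) (1 ≤_) pos (entry-pos c)
  ; entry-≤d      = λ {a} {b} c → replaced (a , b) (_≤ d) ≤d (entry-≤d c)
  ; row-weak      = row-weak′
  ; column-strict = column-strict′
  }
  where
  open Semistandard S
  open FitsAt F
  t′ = update t (x , y) v

  replaced : ∀ a (P : ℕ → Set) → P v → P (t a) → P (t′ a)
  replaced a P Pv Pt with update-cases t (x , y) v a
  ... | inj₁ (_ , eq) = subst P (sym eq) Pv
  ... | inj₂ (_ , eq) = subst P (sym eq) Pt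

  row-weak′ : ∀ {a b} → InDiag μ (a , b) → InDiag μ (a , suc b) → t′ (a , b) ≤ t′ (a , suc b)
  row-weak′ {a} {b} c c′ with update-cases t (x , y) v (a , b) | update-cases t (x , y) v (a , suc b)
  ... | inj₁ (refl , e) | inj₁ (e′ , _) = ⊥-elim (1+n≢n (cong proj₂ e′))
  ... | inj₁ (refl , e) | inj₂ (_ , e′) = subst₂ _≤_ (sym e) (sym e′) (≤right c′)
  ... | inj₂ (_ , e)    | inj₁ (refl , e′) = subst₂ _≤_ (sym e) (sym e′) (left≤ c refl)
  ... | inj₂ (_ , e)    | inj₂ (_ , e′) = subst₂ _≤_ (sym e) (sym e′) (row-weak c c′)

  column-strict′ : ∀ {a b} → InDiag μ (a , b) → InDiag μ (suc a , b) → t′ (a , b) < t′ (suc a , b)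
  column-strict′ {a} {b} c c′ with update-cases t (x , y) v (a , b) | update-cases t (x , y) v (suc a , b)
  ... | inj₁ (refl , e) | inj₁ (e′ , _) = ⊥-elim (1+n≢n (cong proj₁ e′))
  ... | inj₁ (refl , e) | inj₂ (_ , e′) = subst₂ _<_ (sym e) (sym e′) (<below c′)
  ... | inj₂ (_ , e)    | inj₁ (refl , e′) = subst₂ _<_ (sym e) (sym e′) (above< c refl)
  ... | inj₂ (_ , e)    | inj₂ (_ , e′) = subst₂ _<_ (sym e) (sym e′) (column-strict c c′)

north east northeast : Cell → Cell
north     p = (proj₁ p ∸ 1 , proj₂ p)
east      p = (proj₁ p , suc (proj₂ p))
northeast p = (proj₁ p ∸ 1 , suc (proj₂ p))

module _ (d : ℕ) where

  -- The cell (d + 1 - x , y) of [μ̂] moved v - x steps to the north-east.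
  placeAt : ℕ → Cell → Cell
  placeAt v (x , y) = (suc d ∸ v , y + v ∸ x)

  placeAt-suc : ∀ v x y → x ≤ y + v → placeAt (suc v) (x , y) ≡ northeast (placeAt v (x , y))
  placeAt-suc v x y x≤ = cong₂ _,_ (sym (∸-suc (suc d) v))
                                        (trans (cong (_∸ x) (+-suc y v)) (+-∸-assoc 1 x≤))

  placeAt-south : ∀ v x y → placeAt (suc v) (suc x , y) ≡ north (placeAt v (x , y))
  placeAt-south v x y = cong₂ _,_ (sym (∸-suc (suc d) v)) (cong (_∸ suc x) (+-suc y v))

  placeAt-east : ∀ v x y → x ≤ y + v → placeAt v (x , suc y) ≡ east (placeAt v (x , y))
  placeAt-east v x y x≤ = cong (suc d ∸ v ,_) (+-∸-assoc 1 x≤)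

  placeAt-injective : ∀ {v w x y x′ y′} → v ≤ suc d → w ≤ suc d → x ≤ y + v → x′ ≤ y′ + w →
                      placeAt v (x , y) ≡ placeAt w (x′ , y′) → v ≡ w × y + x′ ≡ y′ + x
  placeAt-injective {v} {w} {x} {y} {x′} {y′} v≤ w≤ x≤ x′≤ eq with refl ← ∸-cancelˡ-≡ v≤ w≤ (cong proj₁ eq) =
    refl , +-cancelʳ-≡ v _ _ (begin
      y + x′ + v         ≡⟨ +-assoc-comm y x′ v ⟩
      y + v + x′         ≡⟨ cong (_+ x′) (m∸n+n≡m x≤) ⟨
      y + v ∸ x + x + x′ ≡⟨ cong (λ j → j + x + x′) (cong proj₂ eq) ⟩
      y′ + v ∸ x′ + x + x′ ≡⟨ +-assoc-comm (y′ + v ∸ x′) x x′ ⟩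
      y′ + v ∸ x′ + x′ + x ≡⟨ cong (_+ x) (m∸n+n≡m x′≤) ⟩
      y′ + v + x         ≡⟨ +-assoc-comm y′ v x ⟩
      y′ + x + v         ∎)
    where
    open ≡-Reasoning
    +-assoc-comm : ∀ a b c → a + b + c ≡ a + c + b
    +-assoc-comm = solve-∀

  place : (Cell → ℕ) → Cell → Cell
  place t c = placeAt (t c) c

  diagram : List ℕ → (Cell → ℕ) → List Cell
  diagram μ t = map (place t) (cells μ)

  muHat≡diagram : ∀ μ → muHat d μ ≡ diagram μ proj₁
  muHat≡diagram μ = trans (cong (map _) (cellsOf≡cells μ))
                          (map-cong-∈ (cells μ) λ { {x , y} _ → cong (suc d ∸ x ,_) (sym (m+n∸n≡m y x)) })

  diagram-update : ∀ μ {t t′ : Cell → ℕ} (k : Fin (length (diagram μ t))) →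
                   (∀ a → a ≢ source (place t) (cells μ) k → t′ a ≡ t a) →
                   diagram μ t [ k ]∷= place t′ (source (place t) (cells μ) k) ≡ diagram μ t′
  diagram-update μ {t} {t′} k t′≡t = map-∷= (place t) (place t′) (cells μ) k (cells-unique μ)
    λ a _ a≢c → cong (λ v → placeAt v a) (t′≡t a a≢c)

diagram-cong : ∀ d μ {t t′ : Cell → ℕ} → (∀ {c} → InDiag μ c → t c ≡ t′ c) → diagram d μ t ≡ diagram d μ t′
diagram-cong d μ t≡t′ = map-cong-∈ (cells μ) λ {c} c∈ → cong (λ v → placeAt d v c) (t≡t′ (∈-cells⁻ μ c∈))

Ψ-diagram : ∀ λ′ μ {t} → Semistandard (length λ′) μ t → Ψ λ′ μ (diagram (length λ′) μ t) ≡ tableau μ t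
Ψ-diagram λ′ μ {t} S = cong (chunks μ) (trans (sym (map-∘ (cells μ))) (map-cong-∈ (cells μ) row-of-place))
  where
  row-of-place : ∀ {c} → c ∈ cells μ → suc (length λ′) ∸ proj₁ (place (length λ′) t c) ≡ t c
  row-of-place c∈ = m∸[m∸n]≡n (≤-trans (Semistandard.entry-≤d S (∈-cells⁻ μ c∈)) (n≤1+n _))

NEMove-from : ∀ λ′ {D D′} (k : Fin (length D)) {p} → lookup D k ≡ p →
              Free λ′ D (north p) → Free λ′ D (northeast p) → Free λ′ D (east p) →
              D′ ≡ D [ k ]∷= northeast p → NEMove λ′ D D′
NEMove-from _ k refl north-free northeast-free east-free moved =
  k , north-free , northeast-free , east-free , moved

free : ∀ λ′ {D a b} → a ≡ b → InDiag λ′ a → a ∉ D → Free λ′ D b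
free _ refl a∈λ a∉D = a∈λ , a∉D

-- Excited diagrams are placements of semistandard fillings

module _ (λ′ : List ℕ) {μ : List ℕ} (pμ : IsPartition μ) where
  private
    d = length λ′

  place-∈ : ∀ {t c} → InDiag μ c → place d t c ∈ diagram d μ t
  place-∈ c∈μ = ∈-map⁺ _ (∈-cells⁺ μ c∈μ)

  NEMove-raises : ∀ {t D′} → Semistandard d μ t → NEMove λ′ (diagram d μ t) D′ →
                  ∃ λ t′ → Semistandard d μ t′ × D′ ≡ diagram d μ t′
  NEMove-raises {t} S (k , (north∈λ , north∉) , _ , (_ , east∉) , refl)
    with source (place d t) (cells μ) k in c≡
  ... | (x , y) = update t (x , y) (suc u) , update-semistandard S fits , moved
    where
    open Semistandard S
    u = t (x , y)
    c∈μ : InDiag μ (x , y)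
    c∈μ = ∈-cells⁻ μ (subst (_∈ cells μ) c≡ (source-∈ _ (cells μ) k))
    x≤y+u : x ≤ y + u
    x≤y+u = ≤-trans (row≤entry pμ S c∈μ) (m≤n+m u y)
    p≡ : lookup (diagram d μ t) k ≡ placeAt d u (x , y)
    p≡ = trans (lookup-map-source _ (cells μ) k) (cong (place d t) c≡)
    north≡ : north (lookup (diagram d μ t) k) ≡ placeAt d (suc u) (suc x , y)
    north≡ = trans (cong north p≡) (sym (placeAt-south d u x y))
    east≡ : east (lookup (diagram d μ t) k) ≡ placeAt d u (x , suc y)
    east≡ = trans (cong east p≡) (sym (placeAt-east d u x y x≤y+u))

    suc-u≤d : suc u ≤ d
    suc-u≤d = s≤s⁻¹ (1≤m∸n⇒n<m (proj₁ (subst (InDiag λ′) north≡ north∈λ)))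

    <below : InDiag μ (suc x , y) → suc u < t (suc x , y)
    <below below∈μ = ≤∧≢⇒< (column-strict c∈μ below∈μ) λ u≡ →
      north∉ (subst (_∈ diagram d μ t) (trans (cong (λ v → placeAt d v (suc x , y)) (sym u≡)) (sym north≡))
                    (place-∈ below∈μ))

    ≤right : InDiag μ (x , suc y) → suc u ≤ t (x , suc y)
    ≤right right∈μ = ≤∧≢⇒< (row-weak c∈μ right∈μ) λ u≡ →
      east∉ (subst (_∈ diagram d μ t) (trans (cong (λ v → placeAt d v (x , suc y)) (sym u≡)) (sym east≡))
                   (place-∈ right∈μ))

    fits : FitsAt d μ t x y (suc u)
    fits = record
      { pos    = s≤s z≤n
      ; ≤d     = suc-u≤d
      ; left≤  = λ {y₀} left∈μ y₀+1≡y →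
          ≤-trans (row-mono pμ S left∈μ c∈μ (subst (y₀ ≤_) y₀+1≡y (n≤1+n y₀))) (n≤1+n u)
      ; ≤right = ≤right
      ; above< = λ {x₀} above∈μ x₀+1≡x →
          s≤s (≤-trans (m≤m+n _ _) (column-mono pμ S above∈μ c∈μ (subst (x₀ ≤_) x₀+1≡x (n≤1+n x₀))))
      ; <below = <below
      }

    t′ = update t (x , y) (suc u)
    D = diagram d μ t

    moved : D [ k ]∷= northeast (lookup D k) ≡ diagram d μ t′
    moved = begin
      D [ k ]∷= northeast (lookup D k)                ≡⟨ cong (λ p → D [ k ]∷= northeast p) p≡ ⟩
      D [ k ]∷= northeast (placeAt d u (x , y))       ≡⟨ cong (D [ k ]∷=_) (placeAt-suc d u x y x≤y+u) ⟨
      D [ k ]∷= placeAt d (suc u) (x , y)             ≡⟨ cong (λ v → D [ k ]∷= placeAt d v (x , y)) (update-≡ t (x , y) (suc u)) ⟨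
      D [ k ]∷= place d t′ (x , y)                    ≡⟨ cong (λ c → D [ k ]∷= place d t′ c) c≡ ⟨
      D [ k ]∷= place d t′ (source (place d t) (cells μ) k)
        ≡⟨ diagram-update d μ k (λ a a≢c → update-≢ t (x , y) (suc u) λ a≡c → a≢c (trans a≡c (sym c≡))) ⟩
      diagram d μ t′                                  ∎
      where open ≡-Reasoning

  module _ (μ⊆λ : Contained μ λ′) where

    rowFilling-semistandard : Semistandard d μ proj₁
    rowFilling-semistandard = record
      { entry-pos     = proj₁
      ; entry-≤d      = λ {x} (_ , 1≤y , y≤μx) → at-pos⇒≤length λ′ x (≤-trans 1≤y (≤-trans y≤μx (μ⊆λ x)))
      ; row-weak      = λ _ _ → ≤-refl
      ; column-strict = λ _ _ → ≤-refl
      }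

    Excited⇒diagram : ∀ {D} → Excited λ′ μ D → ∃ λ t → Semistandard d μ t × D ≡ diagram d μ t
    Excited⇒diagram = go (proj₁ , rowFilling-semistandard , muHat≡diagram d μ)
      where
      go : ∀ {D₀ D} → (∃ λ t → Semistandard d μ t × D₀ ≡ diagram d μ t) → Star (NEMove λ′) D₀ D →
           ∃ λ t → Semistandard d μ t × D ≡ diagram d μ t
      go inv                ε           = inv
      go (t , S , refl) (move ◅ moves) = go (NEMove-raises S move) moves

-- Lowering one entry of a semistandard filling

excess : List ℕ → (Cell → ℕ) → ℕ
excess μ t = sum (map (λ c → t c ∸ proj₁ c) (cells μ))

record Lowerable (μ : List ℕ) (t : Cell → ℕ) (x y s : ℕ) : Set where
  field
    inDiag : InDiag μ (x , y)
    entry≡ : t (x , y) ≡ suc s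
    x≤s    : x ≤ s
    left≤  : ∀ {y₀} → InDiag μ (x , y₀) → suc y₀ ≡ y → t (x , y₀) ≤ s
    above< : ∀ {x₀} → InDiag μ (x₀ , y) → suc x₀ ≡ x → t (x₀ , y) < s

module _ {d : ℕ} {μ : List ℕ} (pμ : IsPartition μ) {t : Cell → ℕ} (S : Semistandard d μ t) where
  open Semistandard S

  ∈diagram⇒occupant : ∀ {v x₀ y₀} → v ≤ suc d → x₀ ≤ y₀ + v → placeAt d v (x₀ , y₀) ∈ diagram d μ t →
                      ∃ λ c → InDiag μ c × t c ≡ v × proj₂ c + x₀ ≡ y₀ + proj₁ c
  ∈diagram⇒occupant v≤ x₀≤ p∈ with (x , y) , c∈ , eq ← ∈-map⁻ (place d t) p∈ =
    let c∈μ = ∈-cells⁻ μ c∈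
        v≡t , diagonal = placeAt-injective d v≤ (≤-trans (entry-≤d c∈μ) (n≤1+n d)) x₀≤
                           (≤-trans (row≤entry pμ S c∈μ) (m≤n+m _ y)) eq
    in (x , y) , c∈μ , sym v≡t , sym diagonal

  left-neighbour-cases : ∀ {x y} → InDiag μ (x , y) →
                         (∀ {y₀} → InDiag μ (x , y₀) → suc y₀ ≡ y → t (x , y₀) < t (x , y)) ⊎
                         ∃ λ y₀ → suc y₀ ≡ y × InDiag μ (x , y₀) × t (x , y₀) ≡ t (x , y)
  left-neighbour-cases {y = suc zero}     c = inj₁ λ { {zero} (_ , () , _) _ }
  left-neighbour-cases {y = suc (suc y₀)} c with m≤n⇒m<n∨m≡n (row-weak left c)
    where left = InDiag-left μ c (s≤s z≤n) (n≤1+n _)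
  ... | inj₁ lt = inj₁ λ { _ refl → lt }
  ... | inj₂ eq = inj₂ (suc y₀ , refl , InDiag-left μ c (s≤s z≤n) (n≤1+n _) , eq)

  above-neighbour-cases : ∀ {x y} → InDiag μ (x , y) →
                          (∀ {x₀} → InDiag μ (x₀ , y) → suc x₀ ≡ x → suc (t (x₀ , y)) < t (x , y)) ⊎
                          ∃ λ x₀ → suc x₀ ≡ x × InDiag μ (x₀ , y) × suc (t (x₀ , y)) ≡ t (x , y)
  above-neighbour-cases {x = suc zero}     c = inj₁ λ { {zero} (() , _) _ }
  above-neighbour-cases {x = suc (suc x₀)} c with m≤n⇒m<n∨m≡n (column-strict above c)
    where above = InDiag-up pμ c (s≤s z≤n) (n≤1+n _)
  ... | inj₁ lt = inj₁ λ { _ refl → lt }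
  ... | inj₂ eq = inj₂ (suc x₀ , refl , InDiag-up pμ c (s≤s z≤n) (n≤1+n _) , eq)

  -- Walk left along equal entries, then up along entries decreasing by one; x < t (x , y) is preserved.
  lowerable-exists : ∀ {x y} → InDiag μ (x , y) → x < t (x , y) → ∃ λ x′ → ∃ λ y′ → ∃ λ s → Lowerable μ t x′ y′ s
  lowerable-exists {x} {y} c x<t with left-neighbour-cases c | above-neighbour-cases c
  ... | inj₂ (y₀ , refl , c₀ , eq) | _ = lowerable-exists c₀ (subst (x <_) (sym eq) x<t)
  ... | inj₁ _ | inj₂ (x₀ , refl , c₀ , eq) = lowerable-exists c₀ (s≤s⁻¹ (subst (x <_) (sym eq) x<t))
  ... | inj₁ left< | inj₁ above< = x , y , pred (t (x , y)) , record
    { inDiag = c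
    ; entry≡ = entry≡
    ; x≤s    = s≤s⁻¹ (subst (x <_) entry≡ x<t)
    ; left≤  = λ {y₀} c₀ y₀+1≡y → s≤s⁻¹ (subst (t (x , y₀) <_) entry≡ (left< c₀ y₀+1≡y))
    ; above< = λ {x₀} c₀ x₀+1≡x → s≤s⁻¹ (subst (suc (t (x₀ , y)) <_) entry≡ (above< c₀ x₀+1≡x))
    }
    where
    entry≡ : t (x , y) ≡ suc (pred (t (x , y)))
    entry≡ = sym (suc-pred _ {{>-nonZero (≤-trans (s≤s z≤n) x<t)}})

module Lowering {d : ℕ} {μ : List ℕ} (pμ : IsPartition μ) {t : Cell → ℕ} (S : Semistandard d μ t)
                {x y s : ℕ} (L : Lowerable μ t x y s) where
  open Semistandard S
  open Lowerable L

  t′ : Cell → ℕ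
  t′ = update t (x , y) s

  semistandard : Semistandard d μ t′
  semistandard = update-semistandard S record
    { pos    = ≤-trans (proj₁ inDiag) x≤s
    ; ≤d     = ≤-trans (n≤1+n s) (subst (_≤ d) entry≡ (entry-≤d inDiag))
    ; left≤  = left≤
    ; ≤right = λ c → ≤-trans (n≤1+n s) (subst (_≤ t (x , suc y)) entry≡ (row-weak inDiag c))
    ; above< = above<
    ; <below = λ c → ≤-trans (n≤1+n (suc s)) (subst (_< t (suc x , y)) entry≡ (column-strict inDiag c))
    }

  excess-decreases : excess μ t′ < excess μ t
  excess-decreases = sum-map-strict _ _ (cells μ) (λ {c} _ → ∸-monoˡ-≤ (proj₁ c) (t′≤t c)) (∈-cells⁺ μ inDiag)
    (subst₂ (λ a b → a ∸ x < b ∸ x) (sym (update-≡ t (x , y) s)) (sym entry≡) (∸-monoˡ-< (n<1+n s) x≤s))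
    where
    t′≤t : ∀ c → t′ c ≤ t c
    t′≤t c with update-cases t (x , y) s c
    ... | inj₁ (refl , eq) = subst₂ _≤_ (sym eq) (sym entry≡) (n≤1+n s)
    ... | inj₂ (_ , eq)    = ≤-reflexive eq

  suc-s≤d : suc s ≤ d
  suc-s≤d = subst (_≤ d) entry≡ (entry-≤d inDiag)

  x≤y+s : x ≤ y + s
  x≤y+s = ≤-trans x≤s (m≤n+m s y)

  private
    northwest-bound : ∀ {x′ y′ v} → InDiag μ (x′ , y′) → t′ (x′ , y′) ≡ v → x′ ≤ x → y′ ≤ y → v + (x ∸ x′) ≤ s
    northwest-bound c t′c≡v x′≤x y′≤y = subst₂ (λ u w → u + _ ≤ w) t′c≡v (update-≡ t (x , y) s)
                                               (southeast-mono pμ semistandard c inDiag x′≤x y′≤y)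

    southeast-bound : ∀ {x′ y′ v} → InDiag μ (x′ , y′) → t′ (x′ , y′) ≡ v → (x′ , y′) ≢ (x , y) →
                      x ≤ x′ → y ≤ y′ → suc s + (x′ ∸ x) ≤ v
    southeast-bound c t′c≡v c≢ x≤x′ y≤y′ =
      subst₂ (λ u w → u + _ ≤ w) entry≡ (trans (sym (update-≢ t (x , y) s c≢)) t′c≡v)
             (southeast-mono pμ S inDiag c x≤x′ y≤y′)

    occupant : ∀ {v x₀ y₀} → v ≤ d → x₀ ≤ y₀ + v → placeAt d v (x₀ , y₀) ∈ diagram d μ t′ →
               ∃ λ c → InDiag μ c × t′ c ≡ v × proj₂ c + x₀ ≡ y₀ + proj₁ c
    occupant v≤d = ∈diagram⇒occupant pμ semistandard (≤-trans v≤d (n≤1+n d))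

    x≢ : ∀ {x′ y′} → x ≢ x′ → (x′ , y′) ≢ (x , y)
    x≢ x≢x′ eq = x≢x′ (sym (cong proj₁ eq))

  -- An occupant of one of the three cells a move needs free would lie on a diagonal next to that of
  -- (x , y), with an entry contradicting the monotonicity of t′ (if weakly NW) or t (if weakly SE).
  north∉ : placeAt d (suc s) (suc x , y) ∉ diagram d μ t′
  north∉ p∈
    with (x′ , y′) , c , t′c≡ , diagonal ← occupant suc-s≤d (subst (suc x ≤_) (sym (+-suc y s)) (s≤s x≤y+s)) p∈
       | ≤-<-connex x′ x
  ... | inj₁ x′≤x =
    suc-m+n≰m (northwest-bound c t′c≡ x′≤x (<⇒≤ (cross-≤ (trans (sym (+-suc y′ x)) diagonal) x′≤x)))
  ... | inj₂ x<x′ = m+n≰m (m<n⇒0<n∸m x<x′)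
                          (southeast-bound c t′c≡ (x≢ (<⇒≢ x<x′)) (<⇒≤ x<x′) (cross-≤ (sym diagonal) x<x′))

  northeast∉ : placeAt d (suc s) (x , y) ∉ diagram d μ t′
  northeast∉ p∈
    with (x′ , y′) , c , t′c≡ , diagonal ← occupant suc-s≤d (≤-trans x≤y+s (+-monoʳ-≤ y (n≤1+n s))) p∈
       | ≤-<-connex x′ x
  ... | inj₁ x′≤x = suc-m+n≰m (northwest-bound c t′c≡ x′≤x (cross-≤ diagonal x′≤x))
  ... | inj₂ x<x′ = m+n≰m (m<n⇒0<n∸m x<x′)
                          (southeast-bound c t′c≡ (x≢ (<⇒≢ x<x′)) (<⇒≤ x<x′) (cross-≤ (sym diagonal) (<⇒≤ x<x′)))

  east∉ : placeAt d s (x , suc y) ∉ diagram d μ t′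
  east∉ p∈
    with (x′ , y′) , c , t′c≡ , diagonal ← occupant (≤-trans (n≤1+n s) suc-s≤d) (≤-trans x≤y+s (n≤1+n _)) p∈
       | <-≤-connex x′ x
  ... | inj₁ x′<x = m+n≰m (m<n⇒0<n∸m x′<x)
                          (northwest-bound c t′c≡ (<⇒≤ x′<x) (cross-≤ (trans diagonal (sym (+-suc y x′))) x′<x))
  ... | inj₂ x≤x′ = suc-m+n≰m (southeast-bound c t′c≡ (λ eq → <⇒≢ y<y′ (sym (cong proj₂ eq))) x≤x′ (<⇒≤ y<y′))
    where y<y′ = cross-≤ (sym diagonal) x≤x′

-- Under the hypothesis λ_d ≥ μ_r + d − r

module Bounded {λ′ μ : List ℕ} (pλ : IsPartition λ′) (pμ : IsPartition μ) {r : ℕ} (1≤r : 1 ≤ r)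
         (μr≡μ1 : part μ r ≡ part μ 1) (gap : part μ r + length λ′ ≤ part λ′ (length λ′) + r) where
  private
    d  = length λ′
    λd = part λ′ d

    λd≤ : ∀ {i} → 1 ≤ i → i ≤ d → λd ≤ part λ′ i
    λd≤ 1≤i i≤d = part-antitone pλ 1≤i i≤d

    +-rearrange : ∀ a b c → a + b + c ≡ a + c + b
    +-rearrange = solve-∀

  module _ {t : Cell → ℕ} (S : Semistandard d μ t) where
    open Semistandard S

    -- The only use of the hypothesis on λ_d: every placed cell lies in a column ≤ λ_d.
    t+y≤λd+x : ∀ {x y} → InDiag μ (x , y) → t (x , y) + y ≤ λd + x
    t+y≤λd+x {x} {y} c@(1≤x , 1≤y , y≤μx) with ≤-total x r
    ... | inj₁ x≤r = +-cancelʳ-≤ (r ∸ x) _ _ (begin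
        t (x , y) + y + (r ∸ x)   ≡⟨ +-rearrange (t (x , y)) y (r ∸ x) ⟩
        t (x , y) + (r ∸ x) + y   ≤⟨ +-mono-≤ (≤-trans (column-mono pμ S c cr x≤r) (entry-≤d cr)) y≤μr ⟩
        d + part μ r              ≡⟨ +-comm d _ ⟩
        part μ r + d              ≤⟨ gap ⟩
        λd + r                    ≡⟨ cong (λd +_) (m+[n∸m]≡n x≤r) ⟨
        λd + (x + (r ∸ x))        ≡⟨ +-assoc λd x _ ⟨
        λd + x + (r ∸ x)          ∎)
      where
      open ≤-Reasoning
      y≤μr : y ≤ part μ r
      y≤μr = ≤-trans y≤μx (subst (part μ x ≤_) (sym μr≡μ1) (part-antitone pμ (s≤s z≤n) 1≤x))
      cr : InDiag μ (r , y)
      cr = 1≤r , 1≤y , y≤μr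
    ... | inj₂ r≤x = +-cancelʳ-≤ r _ _ (begin
        t (x , y) + y + r         ≤⟨ +-mono-≤ (+-mono-≤ (entry-≤d c) (≤-trans y≤μx (part-antitone pμ 1≤r r≤x))) r≤x ⟩
        d + part μ r + x          ≡⟨ cong (_+ x) (+-comm d _) ⟩
        part μ r + d + x          ≤⟨ +-monoˡ-≤ x gap ⟩
        λd + r + x                ≡⟨ +-rearrange λd r x ⟩
        λd + x + r                ∎)
      where open ≤-Reasoning

    λd≤λ-row : ∀ {x y} → InDiag μ (x , y) → λd ≤ part λ′ (suc d ∸ t (x , y))
    λd≤λ-row c = λd≤ (m<n⇒0<n∸m (s≤s (entry-≤d c))) (∸-monoʳ-≤ (suc d) (entry-pos c))

    semistandard⇒OOT : OOT λ′ μ (tableau μ t)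
    semistandard⇒OOT =
      map-length-tableau μ t ,
      (λ i j c → subst (λ v → 1 ≤ v × v ≤ d) (sym (entry≡ c)) (entry-pos c , entry-≤d c)) ,
      (λ i j c c′ → subst₂ _≤_ (sym (entry≡ c)) (sym (entry≡ c′)) (row-weak c c′)) ,
      (λ i j c c′ → subst₂ _<_ (sym (entry≡ c)) (sym (entry≡ c′)) (column-strict c c′)) ,
      (λ i j c → subst (λ v → j < part λ′ (suc d ∸ v) + i) (sym (entry≡ c)) (content-bound c))
      where
      entry≡ : ∀ {i j} → InDiag μ (i , j) → entry (tableau μ t) i j ≡ t (i , j)
      entry≡ = entry-tableau μ t
      content-bound : ∀ {i j} → InDiag μ (i , j) → j < part λ′ (suc d ∸ t (i , j)) + i
      content-bound {i} {j} c = begin-strict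
        j                               <⟨ +-monoˡ-≤ j (entry-pos c) ⟩
        t (i , j) + j                   ≤⟨ t+y≤λd+x c ⟩
        λd + i                          ≤⟨ +-monoˡ-≤ i (λd≤λ-row c) ⟩
        part λ′ (suc d ∸ t (i , j)) + i ∎
        where open ≤-Reasoning

    hook-place : ∀ {x y} → InDiag μ (x , y) → hook λ′ (place d t (x , y)) ≡ part λ′ (suc d ∸ t (x , y)) + x ∸ y
    hook-place {x} {y} c = sym (trans (cong (_∸ y) (sym hook+y)) (m+n∸n≡m _ y))
      where
      open ≡-Reasoning
      v  = t (x , y)
      i  = suc d ∸ v
      j  = y + v ∸ x
      λi = part λ′ i
      j+x≡y+v : j + x ≡ y + v
      j+x≡y+v = m∸n+n≡m (≤-trans (row≤entry pμ S c) (m≤n+m v y))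
      j≤λd : j ≤ λd
      j≤λd = +-cancelʳ-≤ x j λd (subst (_≤ λd + x) (trans (+-comm v y) (sym j+x≡y+v)) (t+y≤λd+x c))
      d∸i+1≡v : d ∸ i + 1 ≡ v
      d∸i+1≡v = begin
        d ∸ i + 1   ≡⟨ +-∸-comm 1 (∸-monoʳ-≤ (suc d) (entry-pos c)) ⟨
        d + 1 ∸ i   ≡⟨ cong (_∸ i) (+-comm d 1) ⟩
        suc d ∸ i   ≡⟨ m∸[m∸n]≡n (≤-trans (entry-≤d c) (n≤1+n d)) ⟩
        v           ∎
      hook+y : hook λ′ (place d t (x , y)) + y ≡ λi + x
      hook+y = begin
        (λi ∸ j) + (conj λ′ j ∸ i) + 1 + y  ≡⟨ cong (λ n → (λi ∸ j) + (n ∸ i) + 1 + y) (conj≡length pλ j≤λd) ⟩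
        (λi ∸ j) + (d ∸ i) + 1 + y          ≡⟨ cong (_+ y) (+-assoc (λi ∸ j) (d ∸ i) 1) ⟩
        (λi ∸ j) + (d ∸ i + 1) + y          ≡⟨ cong (λ n → (λi ∸ j) + n + y) d∸i+1≡v ⟩
        (λi ∸ j) + v + y                    ≡⟨ +-assoc (λi ∸ j) v y ⟩
        (λi ∸ j) + (v + y)                  ≡⟨ cong ((λi ∸ j) +_) (trans (+-comm v y) (sym j+x≡y+v)) ⟩
        (λi ∸ j) + (j + x)                  ≡⟨ +-assoc (λi ∸ j) j x ⟨
        (λi ∸ j) + j + x                    ≡⟨ cong (_+ x) (m∸n+n≡m (≤-trans j≤λd (λd≤λ-row c))) ⟩
        λi + x                              ∎

    hookWeight-diagram : hookWeight λ′ (diagram d μ t) ≡ tabWeight λ′ μ (tableau μ t)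
    hookWeight-diagram = cong product (begin
      map (hook λ′) (map (place d t) (cells μ))  ≡⟨ map-∘ (cells μ) ⟨
      map (hook λ′ ∘ place d t) (cells μ)         ≡⟨ map-cong-∈ (cells μ) (hook≡ ∘ ∈-cells⁻ μ) ⟩
      map factor (cells μ)                       ≡⟨ cong (map factor) (cellsOf≡cells μ) ⟨
      map factor (cellsOf μ)                     ∎)
      where
      open ≡-Reasoning
      factor : Cell → ℕ
      factor (x , y) = part λ′ (suc d ∸ entry (tableau μ t) x y) + x ∸ y
      hook≡ : ∀ {c} → InDiag μ c → hook λ′ (place d t c) ≡ factor c
      hook≡ {x , y} c =
        trans (hook-place c) (cong (λ v → part λ′ (suc d ∸ v) + x ∸ y) (sym (entry-tableau μ t c)))

    placeAt-inDiag : ∀ {v x y} → 1 ≤ v → v ≤ d → x < y + v → y + v ≤ λd + x → InDiag λ′ (placeAt d v (x , y))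
    placeAt-inDiag {v} {x} {y} 1≤v v≤d x<y+v y+v≤ =
      m<n⇒0<n∸m (s≤s v≤d) , m<n⇒0<n∸m x<y+v ,
      ≤-trans (m≤n+o⇒m∸n≤o (y + v) x (subst (y + v ≤_) (+-comm λd x) y+v≤))
              (λd≤ (m<n⇒0<n∸m (s≤s v≤d)) (∸-monoʳ-≤ (suc d) 1≤v))

  lowering-NEMove : ∀ {t x y s} (S : Semistandard d μ t) (L : Lowerable μ t x y s) →
                    NEMove λ′ (diagram d μ (Lowering.t′ pμ S L)) (diagram d μ t)
  lowering-NEMove {t} {x} {y} {s} S L
    with k , c≡ ← ∈⇒source (place d (Lowering.t′ pμ S L)) (cells μ) (∈-cells⁺ μ (Lowerable.inDiag L)) =
    NEMove-from λ′ k p≡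
      (free λ′ (placeAt-south d s x y) north∈λ north∉)
      (free λ′ (placeAt-suc d s x y x≤y+s) northeast∈λ northeast∉)
      (free λ′ (placeAt-east d s x y x≤y+s) east∈λ east∉)
      (begin
        diagram d μ t
          ≡⟨ diagram-update d μ k (λ a a≢c → sym (update-≢ t (x , y) s λ a≡c → a≢c (trans a≡c (sym c≡)))) ⟨
        D′ [ k ]∷= place d t (source (place d t′) (cells μ) k) ≡⟨ cong (λ c → D′ [ k ]∷= place d t c) c≡ ⟩
        D′ [ k ]∷= placeAt d (t (x , y)) (x , y)             ≡⟨ cong (λ v → D′ [ k ]∷= placeAt d v (x , y)) entry≡ ⟩
        D′ [ k ]∷= placeAt d (suc s) (x , y)                 ≡⟨ cong (D′ [ k ]∷=_) (placeAt-suc d s x y x≤y+s) ⟩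
        D′ [ k ]∷= northeast (placeAt d s (x , y))           ∎)
    where
    open ≡-Reasoning
    open Lowerable L
    open Lowering pμ S L
    D′ = diagram d μ t′
    p≡ : lookup D′ k ≡ placeAt d s (x , y)
    p≡ = trans (lookup-map-source _ (cells μ) k)
               (trans (cong (place d t′) c≡) (cong (λ v → placeAt d v (x , y)) (update-≡ t (x , y) s)))
    x<y+s : x < y + s
    x<y+s = +-mono-≤ (proj₁ (proj₂ inDiag)) x≤s
    y+suc-s≤ : y + suc s ≤ λd + x
    y+suc-s≤ = subst (λ v → y + v ≤ λd + x) entry≡ (subst (_≤ λd + x) (+-comm _ y) (t+y≤λd+x S inDiag))
    north∈λ : InDiag λ′ (placeAt d (suc s) (suc x , y))
    north∈λ = placeAt-inDiag S (s≤s z≤n) suc-s≤d (subst (suc x <_) (sym (+-suc y s)) (s≤s x<y+s))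
                             (≤-trans y+suc-s≤ (+-monoʳ-≤ λd (n≤1+n x)))
    northeast∈λ : InDiag λ′ (placeAt d (suc s) (x , y))
    northeast∈λ = placeAt-inDiag S (s≤s z≤n) suc-s≤d (≤-trans x<y+s (+-monoʳ-≤ y (n≤1+n s))) y+suc-s≤
    east∈λ : InDiag λ′ (placeAt d s (x , suc y))
    east∈λ = placeAt-inDiag S (≤-trans (proj₁ inDiag) x≤s) (≤-trans (n≤1+n s) suc-s≤d)
                            (≤-trans x<y+s (n≤1+n _)) (subst (_≤ λd + x) (+-suc y s) y+suc-s≤)

  reachable : ∀ n {t} → Semistandard d μ t → excess μ t < n → Star (NEMove λ′) (muHat d μ) (diagram d μ t)
  reachable (suc n) {t} S bound with ≤-everywhere-or-witness t proj₁ (cells μ)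
  ... | inj₁ t≤row =
    subst (Star (NEMove λ′) (muHat d μ)) (trans (muHat≡diagram d μ) (map-cong-∈ (cells μ) row≡t)) ε
    where
    row≡t : ∀ {c} → c ∈ cells μ → place d proj₁ c ≡ place d t c
    row≡t {c} c∈ = cong (λ v → placeAt d v c) (≤-antisym (row≤entry pμ S (∈-cells⁻ μ c∈)) (t≤row c∈))
  ... | inj₂ (c , c∈ , x<t) with x , y , s , L ← lowerable-exists pμ S (∈-cells⁻ μ c∈) x<t =
    reachable n (Lowering.semistandard pμ S L) (≤-trans (Lowering.excess-decreases pμ S L) (s≤s⁻¹ bound))
      ◅◅ (lowering-NEMove S L ◅ ε)

proposition5p9 :
    (λ′ μ : List ℕ) → IsPartition λ′ → IsPartition μ → Contained μ λ′ →
    Connected λ′ μ → ¬ (μ ≡ []) →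
    (r : ℕ) → 1 ≤ r → part μ r ≡ part μ 1 → (∀ i → 1 ≤ i → part μ i ≡ part μ 1 → i ≤ r) →
    part μ r + length λ′ ≤ part λ′ (length λ′) + r →
    ((D : List Cell) → Excited λ′ μ D → OOT λ′ μ (Ψ λ′ μ D)) ×
    ((D D′ : List Cell) → Excited λ′ μ D → Excited λ′ μ D′ → Ψ λ′ μ D ≡ Ψ λ′ μ D′ → D ≡ D′) ×
    ((T : List (List ℕ)) → OOT λ′ μ T → Σ (List Cell) λ D → Excited λ′ μ D × Ψ λ′ μ D ≡ T) ×
    ((D : List Cell) → Excited λ′ μ D → hookWeight λ′ D ≡ tabWeight λ′ μ (Ψ λ′ μ D))
proposition5p9 λ′ μ pλ pμ μ⊆λ _ _ r 1≤r μr≡μ1 _ gap = into-OOT , injective , surjective , weight-preserving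
  where
  open Bounded pλ pμ 1≤r μr≡μ1 gap

  into-OOT : (D : List Cell) → Excited λ′ μ D → OOT λ′ μ (Ψ λ′ μ D)
  into-OOT D ex with t , S , refl ← Excited⇒diagram λ′ pμ μ⊆λ ex =
    subst (OOT λ′ μ) (sym (Ψ-diagram λ′ μ S)) (semistandard⇒OOT S)

  injective : (D D′ : List Cell) → Excited λ′ μ D → Excited λ′ μ D′ → Ψ λ′ μ D ≡ Ψ λ′ μ D′ → D ≡ D′
  injective D D′ ex ex′ eq
    with t , S , refl ← Excited⇒diagram λ′ pμ μ⊆λ ex | t′ , S′ , refl ← Excited⇒diagram λ′ pμ μ⊆λ ex′ =
    diagram-cong _ μ (tableau-injective μ (trans (sym (Ψ-diagram λ′ μ S)) (trans eq (Ψ-diagram λ′ μ S′))))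

  surjective : (T : List (List ℕ)) → OOT λ′ μ T → Σ (List Cell) λ D → Excited λ′ μ D × Ψ λ′ μ D ≡ T
  surjective T oot@(shape , _) = diagram _ μ (entryAt T) , reachable _ S (n<1+n _) ,
    trans (Ψ-diagram λ′ μ S) (subst (λ ν → tableau ν (entryAt T) ≡ T) shape (tableau-entryAt T))
    where S = OOT⇒semistandard {λ′} oot

  weight-preserving : (D : List Cell) → Excited λ′ μ D → hookWeight λ′ D ≡ tabWeight λ′ μ (Ψ λ′ μ D)
  weight-preserving D ex with t , S , refl ← Excited⇒diagram λ′ pμ μ⊆λ ex =
    trans (hookWeight-diagram S) (cong (tabWeight λ′ μ) (sym (Ψ-diagram λ′ μ S)))
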